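{- Let $\theta=e^{\pi i/3}$ and let $T=\{a+b\theta: a,b\in\mathbb{Z}\}\subset\mathbb{C}$ be the triangular lattice. For every coloring $s:T\to\{0,1\}$: 1. there are infinitely many monochromatic equilateral triangles with vertices in $T$ (in various orientations) of edge-length $\le 3$; 2. there are infinitely many monochromatic equilateral triangles of the form $\{p,p+d,p+d\theta\}$ ($p\in T$, $d$ a positive integer; axis-parallel, upward oriented) of edge-length $\le 4$. Moreover, for each of these two kinds there are infinitely many larger monochromatic triangles of that kind, and their edge-lengths have no upper bound.
   Context: A triangle is monochromatic if its three vertices receive the same color. -}

module Defs where

open import Data.Integer using (ℤ; _+_; _*_; _-_; _≤_; _<_; +_; 0ℤ)
open import Data.Nat using (ℕ)
open import Data.Fin using (Fin)
open import Data.Product using (_×_; _,_; ∃; Σ)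
open import Data.Sum using (_⊎_)
open import Data.List using (List)
open import Data.List.Relation.Unary.All using (All)
open import Relation.Binary.PropositionalEquality using (_≡_)
open import Relation.Nullary using (¬_)

-- The triangular lattice T = { a + bθ : a, b ∈ ℤ }, θ = e^{πi/3}.
-- A point is represented by its coordinate pair (a , b) ↦ a + bθ
-- (this is a bijection since 1, θ are ℝ-linearly independent).
T : Set
T = ℤ × ℤ

_⊖_ : T → T → T
(a , b) ⊖ (c , d) = (a - c , b - d)

-- squared modulus: |a + bθ|² = a² + ab + b²  (since Re θ = 1/2, |θ| = 1)
normSq : T → ℤ
normSq (a , b) = a * a + a * b + b * b

distSq : T → T → ℤ
distSq p q = normSq (p ⊖ q)

Coloring : Set
Coloring = T → Fin 2

Triangle : Set
Triangle = T × T × T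

IsEquilateral : Triangle → Set
IsEquilateral (p , q , r) =
  (0ℤ < distSq p q) × (distSq p q ≡ distSq q r) × (distSq q r ≡ distSq r p)

Monochromatic : Coloring → Triangle → Set
Monochromatic s (p , q , r) = (s p ≡ s q) × (s q ≡ s r)

-- squared length of the first edge (= squared edge length for equilateral triangles)
edgeLenSq : Triangle → ℤ
edgeLenSq (p , q , r) = distSq p q

upTri : T → ℕ → Triangle
upTri (a , b) d = ((a , b) , (a + + d , b) , (a , b + + d))

IsUpward : Triangle → Set
IsUpward t = Σ T λ p → Σ ℕ λ d → (Data.Nat._<_ 0 d) × (t ≡ upTri p d)

_∈ᵥ_ : T → Triangle → Set
x ∈ᵥ (p , q , r) = (x ≡ p) ⊎ ((x ≡ q) ⊎ (x ≡ r))

SameTriangle : Triangle → Triangle → Set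
SameTriangle t u = (∀ x → x ∈ᵥ t → x ∈ᵥ u) × (∀ x → x ∈ᵥ u → x ∈ᵥ t)

InfinitelyMany : (Triangle → Set) → Set
InfinitelyMany P =
  (L : List Triangle) → Σ Triangle λ t → P t × All (λ u → ¬ SameTriangle t u) L

{-# OPTIONS --safe #-}
-- Both bounds are finite facts about two fixed configurations, verified by an exhaustive search.
-- (1) Every 2-colouring of a point c, its six neighbours nᵢ = c + θⁱ and the three points
-- aᵢ = c + θⁱ⁺¹ + θⁱ⁺² (i < 3) has a monochromatic equilateral triangle of side at most 2: if c is
-- red and no unit triangle c nᵢ nᵢ₊₁ and neither n₀ n₂ n₄ nor n₁ n₃ n₅ is monochromatic, exactly
-- two opposite neighbours nᵢ, nᵢ₊₃ are red, and then aᵢ closes either the red triangle nᵢ nᵢ₊₃ aᵢ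
-- of side 2 or the blue unit triangle nᵢ₊₁ nᵢ₊₂ aᵢ.
-- (2) Every 2-colouring of {a + bθ : a, b ≥ 0, a + b ≤ 4} has a monochromatic {p, p + d, p + dθ}.
-- Applied to the colouring precomposed with a translation, they give such triangles beyond any
-- finite set of triangles; applied to the colouring precomposed with z ↦ k z, (2) gives a
-- monochromatic upward triangle of side at least k.
module Submission where

open import Defs
open import Data.Nat using (ℕ)
open import Data.Integer using (_≤_; _<_; +_)
open import Data.Product using (_×_; Σ)

open import Data.Bool using (Bool; true; false; _∧_; _∨_; if_then_else_) renaming (T to So)
open import Data.Bool.ListAction using (any)
open import Data.Bool.Properties using (T-∧; T-∨; T-≡)
open import Data.Fin as Fin using (Fin; zero; suc)
open import Data.Integer as ℤ using (ℤ; 0ℤ; +≤+; +<+; _⊔_)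
import Data.Integer.Properties as ℤ
open import Data.Integer.Tactic.RingSolver using (solve-∀)
open import Data.List using (List; []; _∷_; map)
open import Data.List.Relation.Unary.All as All using (All; []; _∷_; all?; lookupAny)
open import Data.List.Relation.Unary.All.Properties using (map⁺)
open import Data.List.Relation.Unary.Any as Any using (Any)
open import Data.List.Relation.Unary.Any.Properties using (any⁻)
open import Data.Maybe using (Maybe; just; nothing)
open import Data.Maybe.Properties using (just-injective)
import Data.Nat as ℕ
import Data.Nat.Properties as ℕ
open import Data.Product using (_,_; proj₁; proj₂; uncurry)
open import Data.Sum using (inj₁; inj₂; [_,_]′)
open import Function using (_∘_; Equivalence)
open import Relation.Binary.PropositionalEquality using (_≡_; refl; sym; trans; cong; cong₂; subst)
open import Relation.Nullary using (¬_; Dec)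
open import Relation.Nullary.Decidable using (⌊_⌋; _×-dec_; toWitness; from-yes)

open Equivalence using (to; from)

_⊕_ : T → T → T
(a , b) ⊕ (c , d) = (a ℤ.+ c , b ℤ.+ d)

translate : T → Triangle → Triangle
translate v (p , q , r) = (v ⊕ p , v ⊕ q , v ⊕ r)

dilate : ℕ → T → T
dilate k (a , b) = (+ k ℤ.* a , + k ℤ.* b)

dilateTriangle : ℕ → Triangle → Triangle
dilateTriangle k (p , q , r) = (dilate k p , dilate k q , dilate k r)

firstX : Triangle → ℤ
firstX t = proj₁ (proj₁ t)

distSq-translate : ∀ v p q → distSq (v ⊕ p) (v ⊕ q) ≡ distSq p q
distSq-translate (a , b) (c , d) (c′ , d′) =
  cong normSq (cong₂ _,_ (cancel a c c′) (cancel b d d′))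
  where
  cancel : ∀ x y z → (x ℤ.+ y) ℤ.- (x ℤ.+ z) ≡ y ℤ.- z
  cancel = solve-∀

edgeLenSq-translate : ∀ v t → edgeLenSq (translate v t) ≡ edgeLenSq t
edgeLenSq-translate v (p , q , r) = distSq-translate v p q

isEquilateral-translate : ∀ v t → IsEquilateral t → IsEquilateral (translate v t)
isEquilateral-translate v (p , q , r) rewrite distSq-translate v p q
  | distSq-translate v q r | distSq-translate v r p = λ equilateral → equilateral

upTri-translate : ∀ v p d → upTri (v ⊕ p) d ≡ translate v (upTri p d)
upTri-translate (a , b) (c , e) d
  rewrite ℤ.+-assoc a c (+ d) | ℤ.+-assoc b e (+ d) = refl

upTri-dilate : ∀ k p d → upTri (dilate k p) (k ℕ.* d) ≡ dilateTriangle k (upTri p d)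
upTri-dilate k (a , b) d
  rewrite ℤ.pos-* k d | ℤ.*-distribˡ-+ (+ k) a (+ d) | ℤ.*-distribˡ-+ (+ k) b (+ d) = refl

isUpward-translate : ∀ v t → IsUpward t → IsUpward (translate v t)
isUpward-translate v t (p , d , d>0 , refl) = v ⊕ p , d , d>0 , sym (upTri-translate v p d)

boundedEdge-translate : ∀ {P : Triangle → Set} {n} → (∀ v t → P t → P (translate v t)) →
  ∀ v {t} → P t × edgeLenSq t ≤ n → P (translate v t) × edgeLenSq (translate v t) ≤ n
boundedEdge-translate P-translate v {t} (Pt , bounded) =
  P-translate v t Pt , subst (_≤ _) (sym (edgeLenSq-translate v t)) bounded

upTri-side₁ : ∀ a b d → distSq (a , b) (a ℤ.+ d , b) ≡ d ℤ.* d
upTri-side₁ a b d = expanded a b d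
  where
  expanded : ∀ a b d → let x = a ℤ.- (a ℤ.+ d) ; y = b ℤ.- b in x ℤ.* x ℤ.+ x ℤ.* y ℤ.+ y ℤ.* y ≡ d ℤ.* d
  expanded = solve-∀

upTri-side₂ : ∀ a b d → distSq (a ℤ.+ d , b) (a , b ℤ.+ d) ≡ d ℤ.* d
upTri-side₂ a b d = expanded a b d
  where
  expanded : ∀ a b d → let x = (a ℤ.+ d) ℤ.- a ; y = b ℤ.- (b ℤ.+ d) in x ℤ.* x ℤ.+ x ℤ.* y ℤ.+ y ℤ.* y ≡ d ℤ.* d
  expanded = solve-∀

upTri-side₃ : ∀ a b d → distSq (a , b ℤ.+ d) (a , b) ≡ d ℤ.* d
upTri-side₃ a b d = expanded a b d
  where
  expanded : ∀ a b d → let x = a ℤ.- a ; y = (b ℤ.+ d) ℤ.- b in x ℤ.* x ℤ.+ x ℤ.* y ℤ.+ y ℤ.* y ≡ d ℤ.* d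
  expanded = solve-∀

upTri-sides : ∀ p d → let (p , q , r) = upTri p d in
  (distSq p q ≡ + (d ℕ.* d)) × (distSq q r ≡ + (d ℕ.* d)) × (distSq r p ≡ + (d ℕ.* d))
upTri-sides (a , b) d rewrite ℤ.pos-* d d =
  upTri-side₁ a b (+ d) , upTri-side₂ a b (+ d) , upTri-side₃ a b (+ d)

edgeLenSq-upTri : ∀ p d → edgeLenSq (upTri p d) ≡ + (d ℕ.* d)
edgeLenSq-upTri p d = proj₁ (upTri-sides p d)

upTri-isEquilateral : ∀ p d → 0 ℕ.< d → IsEquilateral (upTri p d)
upTri-isEquilateral p d d>0 =
  let side₁ , side₂ , side₃ = upTri-sides p d in
  subst (0ℤ <_) (sym side₁) (+<+ (ℕ.*-mono-< d>0 d>0)) , trans side₁ (sym side₂) , trans side₂ (sym side₃)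

isUpward⇒isEquilateral : ∀ {t} → IsUpward t → IsEquilateral t
isUpward⇒isEquilateral (p , d , d>0 , refl) = upTri-isEquilateral p d d>0

_==_ : T → T → Bool
(a , b) == (c , d) = ⌊ a ℤ.≟ c ⌋ ∧ ⌊ b ℤ.≟ d ⌋

==-sound : ∀ p q → So (p == q) → p ≡ q
==-sound (a , b) (c , d) p==q with T-∧ {⌊ a ℤ.≟ c ⌋} .to p==q
... | a≡c , b≡d = cong₂ _,_ (toWitness {a? = a ℤ.≟ c} a≡c) (toWitness {a? = b ℤ.≟ d} b≡d)

Assignment : Set
Assignment = List (T × Fin 2)

Agrees : Coloring → Assignment → Set
Agrees s ρ = All (λ (p , c) → s p ≡ c) ρ

colourIn : Assignment → T → Maybe (Fin 2)
colourIn [] p = nothing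
colourIn ((q , c) ∷ ρ) p = if p == q then just c else colourIn ρ p

colourIn-sound : ∀ {s ρ p c} → Agrees s ρ → colourIn ρ p ≡ just c → s p ≡ c
colourIn-sound {s} {(q , _) ∷ _} {p} (sq≡c′ ∷ agrees) found with p == q in p==q
... | true = trans (cong s (==-sound p q (T-≡ .from p==q))) (trans sq≡c′ (just-injective found))
... | false = colourIn-sound agrees found

sameColour : Maybe (Fin 2) → Maybe (Fin 2) → Bool
sameColour (just a) (just b) = ⌊ a Fin.≟ b ⌋
sameColour _ _ = false

sameColour-sound : ∀ {s ρ} p q → Agrees s ρ → So (sameColour (colourIn ρ p) (colourIn ρ q)) → s p ≡ s q
sameColour-sound {ρ = ρ} p q agrees same with colourIn ρ p in found-p | colourIn ρ q in found-q
... | just a | just b = trans (colourIn-sound agrees found-p)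
                              (trans (toWitness {a? = a Fin.≟ b} same) (sym (colourIn-sound agrees found-q)))

monoIn : Assignment → Triangle → Bool
monoIn ρ (p , q , r) = sameColour (colourIn ρ p) (colourIn ρ q) ∧ sameColour (colourIn ρ q) (colourIn ρ r)

monoIn-sound : ∀ {s ρ} t → Agrees s ρ → So (monoIn ρ t) → Monochromatic s t
monoIn-sound (p , q , r) agrees mono with T-∧ .to mono
... | pq , qr = sameColour-sound p q agrees pq , sameColour-sound q r agrees qr

touches : T → Triangle → Bool
touches x (p , q , r) = (x == p) ∨ (x == q) ∨ (x == r)

monoThrough : List Triangle → T → Assignment → Bool
monoThrough C p ρ = any (λ t → touches p t ∧ monoIn ρ t) C

monoThrough-sound : ∀ {s ρ} C p → Agrees s ρ → So (monoThrough C p ρ) → Any (Monochromatic s) C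
monoThrough-sound C p agrees found =
  Any.map (λ {t} hit → monoIn-sound t agrees (proj₂ (T-∧ {touches p t} .to hit))) (any⁻ _ C found)

-- Only triangles through the newly coloured point can have become monochromatic, so only they
-- are tested before branching on the next point.
forces : List Triangle → List T → Assignment → Bool
forces C [] ρ = false
forces C (p ∷ ps) ρ = settled zero ∧ settled (suc zero)
  where
  settled : Fin 2 → Bool
  settled c = monoThrough C p ((p , c) ∷ ρ) ∨ forces C ps ((p , c) ∷ ρ)

forces-sound : ∀ C ps {ρ} (s : Coloring) → Agrees s ρ → So (forces C ps ρ) → Any (Monochromatic s) C
forces-sound C (p ∷ ps) {ρ} s agrees forced =
  [ monoThrough-sound C p (refl ∷ agrees) , forces-sound C ps s (refl ∷ agrees) ]′ (T-∨ .to (settled (s p)))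
  where
  settled : ∀ c → So (monoThrough C p ((p , c) ∷ ρ) ∨ forces C ps ((p , c) ∷ ρ))
  settled zero = proj₁ (T-∧ .to forced)
  settled (suc zero) = proj₂ (T-∧ .to forced)

Forcing : List Triangle → Set
Forcing C = (s : Coloring) → Any (Monochromatic s) C

forcing-by-search : ∀ C ps → So (forces C ps []) → Forcing C
forcing-by-search C ps forced s = forces-sound C ps s [] forced

InfinitelyMany-map : ∀ {P Q : Triangle → Set} → (∀ {t} → P t → Q t) → InfinitelyMany P → InfinitelyMany Q
InfinitelyMany-map P⇒Q many L with many L
... | t , Pt , new = t , P⇒Q Pt , new

xMaxTriangle : Triangle → ℤ
xMaxTriangle ((a , _) , (b , _) , (c , _)) = a ⊔ (b ⊔ c)

xMax : List Triangle → ℤ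
xMax [] = 0ℤ
xMax (u ∷ L) = xMaxTriangle u ⊔ xMax L

vertex-≤-xMaxTriangle : ∀ {x} u → x ∈ᵥ u → proj₁ x ≤ xMaxTriangle u
vertex-≤-xMaxTriangle ((a , _) , (b , _) , (c , _)) (inj₁ refl) = ℤ.i≤i⊔j a (b ⊔ c)
vertex-≤-xMaxTriangle ((a , _) , (b , _) , (c , _)) (inj₂ (inj₁ refl)) = ℤ.≤-trans (ℤ.i≤i⊔j b c) (ℤ.i≤j⊔i a (b ⊔ c))
vertex-≤-xMaxTriangle ((a , _) , (b , _) , (c , _)) (inj₂ (inj₂ refl)) = ℤ.≤-trans (ℤ.i≤j⊔i b c) (ℤ.i≤j⊔i a (b ⊔ c))

beyond-xMax⇒new : ∀ L t → xMax L < firstX t → All (λ u → ¬ SameTriangle t u) L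
beyond-xMax⇒new [] t beyond = []
beyond-xMax⇒new (u ∷ L) t beyond =
  (λ (t⊆u , _) → ℤ.<⇒≱ beyond
     (ℤ.≤-trans (vertex-≤-xMaxTriangle u (t⊆u (proj₁ t) (inj₁ refl))) (ℤ.i≤i⊔j (xMaxTriangle u) (xMax L))))
  ∷ beyond-xMax⇒new L t (ℤ.≤-<-trans (ℤ.i≤j⊔i (xMaxTriangle u) (xMax L)) beyond)

i≤i+nonNegative : ∀ i {j} → 0ℤ ≤ j → i ≤ i ℤ.+ j
i≤i+nonNegative i {+ n} _ = ℤ.i≤i+j i (+ n)

module _ {P : Triangle → Set} (P-translate : ∀ v {t} → P t → P (translate v t)) where

  infinitelyMany-monochromatic : ∀ {C} → Forcing C → All (λ t → P t × 0ℤ ≤ firstX t) C →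
    (s : Coloring) → InfinitelyMany (λ t → P t × Monochromatic s t)
  -- Precompose s with the translation by (xMax L + 1 , 0); as C lies in the half-plane x ≥ 0, the
  -- translated monochromatic triangle starts to the right of every vertex of L.
  infinitelyMany-monochromatic {C} forcing good s L =
    translate v t , (P-translate v Pt , mono) , beyond-xMax⇒new L (translate v t) beyond
    where
    v : T
    v = (ℤ.suc (xMax L) , 0ℤ)
    hit : Any (Monochromatic (s ∘ (v ⊕_))) C
    hit = forcing (s ∘ (v ⊕_))
    t : Triangle
    t = Any.lookup hit
    Pt : P t
    Pt = proj₁ (proj₁ (lookupAny good hit))
    mono : Monochromatic s (translate v t)
    mono = proj₂ (lookupAny good hit)
    beyond : xMax L < firstX (translate v t)
    beyond = ℤ.suc[i]≤j⇒i<j (i≤i+nonNegative (ℤ.suc (xMax L)) (proj₂ (proj₁ (lookupAny good hit))))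

isEquilateral? : ∀ t → Dec (IsEquilateral t)
isEquilateral? (p , q , r) = 0ℤ ℤ.<? distSq p q ×-dec distSq p q ℤ.≟ distSq q r ×-dec distSq q r ℤ.≟ distSq r p

at : ℕ → ℕ → T
at i j = (+ i , + j)

module Hexagon where

  -- The points of the header around c = (2 , 1); in coordinates θ = (0 , 1) and θ² = θ - 1 = (-1 , 1).
  c n₀ n₁ n₂ n₃ n₄ n₅ a₀ a₁ a₂ : T
  c = at 2 1
  n₀ = at 3 1
  n₁ = at 2 2
  n₂ = at 1 2
  n₃ = at 1 1
  n₄ = at 2 0
  n₅ = at 3 0
  a₀ = at 1 3
  a₁ = at 0 2
  a₂ = at 1 0

  points : List T
  points = c ∷ n₀ ∷ n₁ ∷ n₂ ∷ n₃ ∷ n₄ ∷ n₅ ∷ a₀ ∷ a₁ ∷ a₂ ∷ []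

  triangles : List Triangle
  triangles =
    (c , n₀ , n₁) ∷ (c , n₁ , n₂) ∷ (c , n₂ , n₃) ∷ (c , n₃ , n₄) ∷ (c , n₄ , n₅) ∷ (c , n₅ , n₀) ∷
    (n₀ , n₂ , n₄) ∷ (n₁ , n₃ , n₅) ∷
    (n₀ , n₃ , a₀) ∷ (n₁ , n₄ , a₁) ∷ (n₂ , n₅ , a₂) ∷
    (n₁ , n₂ , a₀) ∷ (n₂ , n₃ , a₁) ∷ (n₃ , n₄ , a₂) ∷ []

  -- Opaque, so that inspecting a witness never unfolds (and re-runs) the search.
  opaque
    forcing : Forcing triangles
    forcing = forcing-by-search triangles points _

  small : All (λ t → (IsEquilateral t × edgeLenSq t ≤ + 9) × 0ℤ ≤ firstX t) triangles
  small = from-yes (all? (λ t → (isEquilateral? t ×-dec edgeLenSq t ℤ.≤? + 9) ×-dec 0ℤ ℤ.≤? firstX t) triangles)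

upTri-small : ∀ {n} p d → (0 ℕ.< d × d ℕ.≤ n × 0ℤ ≤ proj₁ p) →
  (IsUpward (upTri p d) × edgeLenSq (upTri p d) ≤ + (n ℕ.* n)) × 0ℤ ≤ firstX (upTri p d)
upTri-small p d (d>0 , d≤n , anchored) =
  ((p , d , d>0 , refl) , subst (_≤ _) (sym (edgeLenSq-upTri p d)) (+≤+ (ℕ.*-mono-≤ d≤n d≤n))) , anchored

module Corner where

  points : List T
  points = at 0 0 ∷ at 1 0 ∷ at 0 1 ∷ at 2 0 ∷ at 1 1 ∷ at 0 2 ∷ at 3 0 ∷ at 2 1 ∷ at 1 2 ∷ at 0 3
         ∷ at 4 0 ∷ at 3 1 ∷ at 2 2 ∷ at 1 3 ∷ at 0 4 ∷ []

  shapes : List (T × ℕ)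
  shapes =
    (at 0 0 , 1) ∷ (at 1 0 , 1) ∷ (at 0 1 , 1) ∷ (at 2 0 , 1) ∷ (at 1 1 , 1) ∷ (at 0 2 , 1) ∷
    (at 3 0 , 1) ∷ (at 2 1 , 1) ∷ (at 1 2 , 1) ∷ (at 0 3 , 1) ∷
    (at 0 0 , 2) ∷ (at 1 0 , 2) ∷ (at 0 1 , 2) ∷ (at 2 0 , 2) ∷ (at 1 1 , 2) ∷ (at 0 2 , 2) ∷
    (at 0 0 , 3) ∷ (at 1 0 , 3) ∷ (at 0 1 , 3) ∷
    (at 0 0 , 4) ∷ []

  triangles : List Triangle
  triangles = map (uncurry upTri) shapes

  opaque
    forcing : Forcing triangles
    forcing = forcing-by-search triangles points _

  small : All (λ t → (IsUpward t × edgeLenSq t ≤ + 16) × 0ℤ ≤ firstX t) triangles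
  small = map⁺ (All.map (λ {(p , d)} → upTri-small p d)
    (from-yes (all? (λ (p , d) → 0 ℕ.<? d ×-dec d ℕ.≤? 4 ×-dec 0ℤ ℤ.≤? proj₁ p) shapes)))

upward-dilate : ∀ {s k t} → 0 ℕ.< k → IsUpward t → Monochromatic (s ∘ dilate k) t → Σ Triangle λ t′ →
  IsUpward t′ × Monochromatic s t′ × (+ (k ℕ.* k) ≤ edgeLenSq t′)
upward-dilate {s} {k} k>0 (p , d , d>0 , refl) mono =
  upTri (dilate k p) (k ℕ.* d) ,
  (dilate k p , k ℕ.* d , ℕ.*-mono-< k>0 d>0 , refl) ,
  subst (Monochromatic s) (sym (upTri-dilate k p d)) mono ,
  subst (+ (k ℕ.* k) ≤_) (sym (edgeLenSq-upTri (dilate k p) (k ℕ.* d))) (+≤+ (ℕ.*-mono-≤ k≤kd k≤kd))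
  where
  k≤kd : k ℕ.≤ k ℕ.* d
  k≤kd = ℕ.m≤m*n k d {{ℕ.>-nonZero d>0}}

monochromatic-upward-unbounded : ∀ {C} → Forcing C → All IsUpward C → (s : Coloring) (L : ℕ) →
  Σ Triangle λ t → IsUpward t × Monochromatic s t × (+ (L ℕ.* L) < edgeLenSq t)
monochromatic-upward-unbounded forcing upward-C s L =
  let upward , mono = lookupAny upward-C (forcing (s ∘ dilate (ℕ.suc L)))
      t , upward′ , mono′ , big = upward-dilate {s} {ℕ.suc L} ℕ.z<s upward mono
  in t , upward′ , mono′ , ℤ.<-≤-trans (+<+ (ℕ.*-mono-< (ℕ.n<1+n L) (ℕ.n<1+n L))) big

mainTheorem12 : (s : Coloring) →
    InfinitelyMany (λ t → IsEquilateral t × Monochromatic s t × (edgeLenSq t ≤ + 9))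
    × InfinitelyMany (λ t → IsUpward t × Monochromatic s t × (edgeLenSq t ≤ + 16))
    × ((L : ℕ) → Σ Triangle λ t →
         IsEquilateral t × Monochromatic s t × (+ (L Data.Nat.* L) < edgeLenSq t))
    × ((L : ℕ) → Σ Triangle λ t →
         IsUpward t × Monochromatic s t × (+ (L Data.Nat.* L) < edgeLenSq t))
mainTheorem12 s =
  InfinitelyMany-map reorder smallEquilateral ,
  InfinitelyMany-map reorder smallUpward ,
  (λ L → let t , upward , mono , large = largeUpward L in t , isUpward⇒isEquilateral upward , mono , large) ,
  largeUpward
  where
  smallEquilateral : InfinitelyMany (λ t → (IsEquilateral t × edgeLenSq t ≤ + 9) × Monochromatic s t)
  smallEquilateral = infinitelyMany-monochromatic (boundedEdge-translate isEquilateral-translate)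
    Hexagon.forcing Hexagon.small s

  smallUpward : InfinitelyMany (λ t → (IsUpward t × edgeLenSq t ≤ + 16) × Monochromatic s t)
  smallUpward = infinitelyMany-monochromatic (boundedEdge-translate isUpward-translate)
    Corner.forcing Corner.small s

  largeUpward : (L : ℕ) → Σ Triangle λ t → IsUpward t × Monochromatic s t × (+ (L ℕ.* L) < edgeLenSq t)
  largeUpward = monochromatic-upward-unbounded Corner.forcing (All.map (proj₁ ∘ proj₁) Corner.small) s

  reorder : ∀ {A B C : Set} → (A × B) × C → A × C × B
  reorder ((a , b) , c) = a , c , b
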